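{- Let $M$ be a matroid on a finite ground set $E$ with rank function $r$, and $k>0$ an integer. Let $\sigma=\{(A_i,B_i):i=0,\dots,n\}$ be a star of bipartitions of $E$ with $\|\sigma\|:=\sum_{i=0}^n r(B_i)-n\,r(M)<k$. Then $\lambda(A_i)<k$ for every $i$, i.e. $\sigma\subseteq\vec S_k$.
   Context: $\lambda(X)=r(X)+r(E\setminus X)-r(M)$ is the connectivity function. $\vec U$ is the set of all bipartitions $(X,Y)$ of $E$ (ordered pairs with $X\cup Y=E$, $X\cap Y=\emptyset$, parts possibly empty), with $(A,B)\le(C,D)$ iff $A\subseteq C$ and $B\supseteq D$, inverse $(B,A)$. $\mathrm{ord}(X,Y)=\lambda(X)=\lambda(Y)$, and $\vec S_k=\{(X,Y)\in\vec U:\mathrm{ord}(X,Y)<k\}$. A star is a nonempty set $\sigma\subseteq\vec U$ such that $\vec r\le\overleftarrow s$ for all distinct $\vec r,\vec s\in\sigma$, where $\overleftarrow s$ is the inverse of $\vec s$. -}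

module Defs where

open import Data.Nat using (ℕ; suc; _+_; _*_; _∸_; _≤_; _<_)
open import Data.Fin using (Fin)
open import Data.Fin.Subset using (Subset; _⊆_; _∪_; _∩_; ∁; ⊤; ∣_∣)
open import Data.Product using (_×_; Σ; proj₁; proj₂; _,_)
open import Relation.Binary.PropositionalEquality using (_≡_; _≢_; trans)
open import Data.Fin.Subset.Properties using (∪-comm; ∩-comm)
open import Data.List using (tabulate)
open import Data.Nat.ListAction using (sum)

record Matroid (m : ℕ) : Set where
  field
    r           : Subset m → ℕ
    r-card      : ∀ X → r X ≤ ∣ X ∣
    r-mono      : ∀ {X Y} → X ⊆ Y → r X ≤ r Y
    r-submod    : ∀ X Y → r (X ∪ Y) + r (X ∩ Y) ≤ r X + r Y

open Matroid public

rM : ∀ {m} → Matroid m → ℕ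
rM M = r M ⊤

-- connectivity function λ(X) = r(X) + r(E∖X) - r(M)
-- (truncated subtraction is exact here, since r(X)+r(E∖X) ≥ r(M) by R3 + R1)
conn : ∀ {m} → Matroid m → Subset m → ℕ
conn M X = r M X + r M (∁ X) ∸ rM M

-- bipartitions (X , Y) of E: X ∪ Y = E and X ∩ Y = ∅ (parts may be empty)
Bipartition : ℕ → Set
Bipartition m = Σ (Subset m × Subset m) λ p →
  (proj₁ p ∪ proj₂ p ≡ ⊤) × (proj₁ p ∩ proj₂ p ≡ Data.Fin.Subset.⊥)

left right : ∀ {m} → Bipartition m → Subset m
left  s = proj₁ (proj₁ s)
right s = proj₂ (proj₁ s)

_≤ᵇ_ : ∀ {m} → Bipartition m → Bipartition m → Set
s ≤ᵇ t = (left s ⊆ left t) × (right t ⊆ right s)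

inv : ∀ {m} → Bipartition m → Bipartition m
inv ((X , Y) , (c , d)) =
  ((Y , X) , (trans (∪-comm Y X) c , trans (∩-comm Y X) d))

ord : ∀ {m} → Matroid m → Bipartition m → ℕ
ord M s = conn M (left s)

-- a star given as an indexed family σ_0,…,σ_n of pairwise distinct
-- bipartitions with σ_i ≤ inverse(σ_j) for i ≠ j (nonempty: n+1 ≥ 1 members)
IsStar : ∀ {m n} → (Fin (suc n) → Bipartition m) → Set
IsStar {n = n} σ =
  (∀ i j → proj₁ (σ i) ≡ proj₁ (σ j) → i ≡ j) ×
  (∀ i j → i ≢ j → σ i ≤ᵇ inv (σ j))

sumRightRanks : ∀ {m n} → Matroid m → (Fin n → Bipartition m) → ℕ
sumRightRanks M σ = sum (tabulate (λ i → r M (right (σ i))))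

module Submission where

-- Write σ = {(A_j , B_j)} and fix i.  Since the parts of a
-- bipartition are complementary, r(E∖A_i) ≤ r(B_i).  For j ≠ i the star
-- condition gives A_i ⊆ B_j, so r(A_i) ≤ r(⋂_{j≠i} B_j).  The sets B_j are
-- pairwise co-disjoint (E∖B_j ⊆ A_j ⊆ B_l for j ≠ l), and for such a family
-- of n sets iterated submodularity yields
--     r(⋂_j B_j) + n·r(M) ≤ Σ_j r(B_j) + r(M).
-- Adding the three bounds, r(A_i) + r(E∖A_i) + n·r(M) ≤ Σ_j r(B_j) + r(M),
-- which together with Σ_j r(B_j) < k + n·r(M) gives λ(A_i) < k.

open import Defs
open import Data.Nat using (ℕ; zero; suc; _+_; _*_; _≤_; _<_; >-nonZero)
open import Data.Nat.Properties
  using (≤-reflexive; ≤-trans; +-identityʳ; +-assoc; +-monoˡ-≤; +-monoʳ-≤;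
         +-monoˡ-<; +-cancelʳ-<; m<n+o⇒m∸n<o; module ≤-Reasoning)
open import Data.Nat.Solver using (module +-*-Solver)
open import Data.Nat.ListAction using (sum)
open import Data.Fin using (Fin; punchIn) renaming (zero to fzero; suc to fsuc)
open import Data.Fin.Properties using (suc-injective; punchIn-injective; punchInᵢ≢i)
open import Data.Fin.Subset using (Subset; _⊆_; _∪_; _∩_; ∁; ⊤; ⋂; _∈_)
open import Data.Fin.Subset.Properties
  using (_∈?_; ∈⊤; x∈p∩q⁺; x∈p∪q⁺; x∈p∪q⁻; x∈∁p⇒x∉p; x∉p⇒x∈∁p)
open import Data.List using (tabulate)
open import Data.Product using (proj₁; proj₂; _,_)
open import Data.Sum using (inj₁; inj₂)
open import Data.Empty using (⊥-elim)
open import Relation.Nullary using (yes; no)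
open import Relation.Binary.PropositionalEquality
  using (_≡_; _≢_; refl; sym; cong; subst; module ≡-Reasoning)
open +-*-Solver using (solve; _:=_; _:+_)

∪≡⊤⇒∁⊆ : ∀ {m} {X Y : Subset m} → X ∪ Y ≡ ⊤ → ∁ X ⊆ Y
∪≡⊤⇒∁⊆ {X = X} {Y} cover {x} x∈∁X
  with x∈p∪q⁻ X Y (subst (x ∈_) (sym cover) ∈⊤)
... | inj₁ x∈X = ⊥-elim (x∈∁p⇒x∉p x∈∁X x∈X)
... | inj₂ x∈Y = x∈Y

∁⊆⇒⊤⊆∪ : ∀ {m} {X Y : Subset m} → ∁ X ⊆ Y → ⊤ ⊆ X ∪ Y
∁⊆⇒⊤⊆∪ {X = X} ∁X⊆Y {x} _ with x ∈? X
... | yes x∈X = x∈p∪q⁺ (inj₁ x∈X)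
... | no  x∉X = x∈p∪q⁺ (inj₂ (∁X⊆Y (x∉p⇒x∈∁p x∉X)))

⊆-⋂ : ∀ {m n} (B : Fin n → Subset m) {X : Subset m} →
  (∀ j → X ⊆ B j) → X ⊆ ⋂ (tabulate B)
⊆-⋂ {n = zero}  B X⊆B x∈X = ∈⊤
⊆-⋂ {n = suc n} B X⊆B x∈X =
  x∈p∩q⁺ (X⊆B fzero x∈X , ⊆-⋂ (λ j → B (fsuc j)) (λ j → X⊆B (fsuc j)) x∈X)

-- In the induction step B_0 ∪ ⋂_{j>0} B_j = E, so submodularity applied to
-- B_0 and ⋂_{j>0} B_j loses exactly one copy of r(M).
codisjoint-rank-bound : ∀ {m} (M : Matroid m) n (B : Fin n → Subset m) →
  (∀ j l → j ≢ l → ∁ (B j) ⊆ B l) →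
  r M (⋂ (tabulate B)) + n * rM M ≤ sum (tabulate (λ j → r M (B j))) + rM M
codisjoint-rank-bound M zero B codisjoint = ≤-reflexive (+-identityʳ _)
codisjoint-rank-bound M (suc n) B codisjoint = begin
  r M (B₀ ∩ J) + (rM M + n * rM M)     ≤⟨ +-monoʳ-≤ (r M (B₀ ∩ J)) (+-monoˡ-≤ (n * rM M) B₀∪J-spans) ⟩
  r M (B₀ ∩ J) + (r M (B₀ ∪ J) + n * rM M)
    ≡⟨ solve 3 (λ a u t → a :+ (u :+ t) := (u :+ a) :+ t) refl (r M (B₀ ∩ J)) (r M (B₀ ∪ J)) (n * rM M) ⟩
  (r M (B₀ ∪ J) + r M (B₀ ∩ J)) + n * rM M ≤⟨ +-monoˡ-≤ (n * rM M) (r-submod M B₀ J) ⟩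
  (r M B₀ + r M J) + n * rM M          ≡⟨ +-assoc (r M B₀) (r M J) (n * rM M) ⟩
  r M B₀ + (r M J + n * rM M)          ≤⟨ +-monoʳ-≤ (r M B₀) induction-hypothesis ⟩
  r M B₀ + (rest + rM M)               ≡⟨ +-assoc (r M B₀) rest (rM M) ⟨
  (r M B₀ + rest) + rM M               ∎
  where
    open ≤-Reasoning
    B₀ = B fzero
    B′ : Fin n → Subset _
    B′ j = B (fsuc j)
    J = ⋂ (tabulate B′)
    rest = sum (tabulate (λ j → r M (B′ j)))
    induction-hypothesis : r M J + n * rM M ≤ rest + rM M
    induction-hypothesis = codisjoint-rank-bound M n B′
      (λ j l j≢l → codisjoint (fsuc j) (fsuc l) (λ eq → j≢l (suc-injective eq)))
    B₀∪J-spans : rM M ≤ r M (B₀ ∪ J)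
    B₀∪J-spans = r-mono M (∁⊆⇒⊤⊆∪ (⊆-⋂ B′ (λ j → codisjoint fzero (fsuc j) (λ ()))))

sum-split : ∀ n (f : Fin (suc n) → ℕ) (i : Fin (suc n)) →
  sum (tabulate f) ≡ f i + sum (tabulate (λ j → f (punchIn i j)))
sum-split n       f fzero    = refl
sum-split (suc n) f (fsuc i) = begin
  f fzero + sum (tabulate (λ j → f (fsuc j)))
    ≡⟨ cong (f fzero +_) (sum-split n (λ j → f (fsuc j)) i) ⟩
  f fzero + (f (fsuc i) + rest)
    ≡⟨ solve 3 (λ a b c → a :+ (b :+ c) := b :+ (a :+ c)) refl (f fzero) (f (fsuc i)) rest ⟩
  f (fsuc i) + (f fzero + rest) ∎
  where
    open ≡-Reasoning
    rest = sum (tabulate (λ j → f (fsuc (punchIn i j))))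

module _ {m n} {σ : Fin (suc n) → Bipartition m} (star : IsStar σ) where

  left⊆right : ∀ i j → i ≢ j → left (σ i) ⊆ right (σ j)
  left⊆right i j i≢j = proj₁ (proj₂ star i j i≢j)

  rights-codisjoint : ∀ i j → i ≢ j → ∁ (right (σ i)) ⊆ right (σ j)
  rights-codisjoint i j i≢j x∉B = left⊆right i j i≢j (∪≡⊤⇒∁⊆ (proj₁ (proj₂ (inv (σ i)))) x∉B)

  star-member-bound : ∀ (M : Matroid m) i →
    (r M (left (σ i)) + r M (∁ (left (σ i)))) + n * rM M ≤ sumRightRanks M σ + rM M
  star-member-bound M i = begin
    (r M A + r M (∁ A)) + n * rM M  ≤⟨ +-monoˡ-≤ (n * rM M) (+-monoʳ-≤ (r M A) ∁A-bound) ⟩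
    (r M A + r M B) + n * rM M
      ≡⟨ solve 3 (λ a b c → (a :+ b) :+ c := b :+ (a :+ c)) refl (r M A) (r M B) (n * rM M) ⟩
    r M B + (r M A + n * rM M)      ≤⟨ +-monoʳ-≤ (r M B) others-bound ⟩
    r M B + (others + rM M)         ≡⟨ +-assoc (r M B) others (rM M) ⟨
    (r M B + others) + rM M         ≡⟨ cong (_+ rM M) (sum-split n (λ j → r M (right (σ j))) i) ⟨
    sumRightRanks M σ + rM M        ∎
    where
      open ≤-Reasoning
      A = left (σ i)
      B = right (σ i)
      Bᵒ : Fin n → Subset m
      Bᵒ j = right (σ (punchIn i j))
      others = sum (tabulate (λ j → r M (Bᵒ j)))
      ∁A-bound : r M (∁ A) ≤ r M B
      ∁A-bound = r-mono M (∪≡⊤⇒∁⊆ (proj₁ (proj₂ (σ i))))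
      A⊆⋂Bᵒ : A ⊆ ⋂ (tabulate Bᵒ)
      A⊆⋂Bᵒ = ⊆-⋂ Bᵒ (λ j → left⊆right i (punchIn i j) (λ eq → punchInᵢ≢i i j (sym eq)))
      others-bound : r M A + n * rM M ≤ others + rM M
      others-bound = ≤-trans (+-monoˡ-≤ (n * rM M) (r-mono M A⊆⋂Bᵒ))
        (codisjoint-rank-bound M n Bᵒ (λ j l j≢l →
          rights-codisjoint (punchIn i j) (punchIn i l) (λ eq → j≢l (punchIn-injective i j l eq))))

lemma5p14 : ∀ {m : ℕ} (M : Matroid m) (k : ℕ) → 0 < k →
    ∀ (n : ℕ) (σ : Fin (suc n) → Bipartition m) → IsStar σ →
    sumRightRanks M σ < k + n * rM M →
    ∀ (i : Fin (suc n)) → ord M (σ i) < k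
lemma5p14 M k k>0 n σ star small-norm i =
  m<n+o⇒m∸n<o (r M A + r M (∁ A)) (rM M) {{>-nonZero k>0}} ranks<rM+k
  where
    A = left (σ i)
    ranks<rM+k : r M A + r M (∁ A) < rM M + k
    ranks<rM+k = +-cancelʳ-< (n * rM M) (r M A + r M (∁ A)) (rM M + k) (begin-strict
      (r M A + r M (∁ A)) + n * rM M  ≤⟨ star-member-bound {σ = σ} star M i ⟩
      sumRightRanks M σ + rM M        <⟨ +-monoˡ-< (rM M) small-norm ⟩
      (k + n * rM M) + rM M
        ≡⟨ solve 3 (λ k a e → (k :+ a) :+ e := (e :+ k) :+ a) refl k (n * rM M) (rM M) ⟩
      (rM M + k) + n * rM M           ∎)
      where open ≤-Reasoning
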